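{- Let $k=ff'$ be an odd positive integer, where $f,f'$ are positive integers with $1<f<k$. If $x^2-(k^2+1)y^2=f'^2$ for some coprime integers $x$ and $y$, then $f'$ is not a prime power.
   Context: A prime power means an integer of the form $p^m$ with $p$ prime and $m\ge 1$. -}

module Defs where

open import Data.Nat using (ℕ; suc; _*_; _+_; _^_; _≥_)
open import Data.Nat.Primality using (Prime)
open import Data.Product using (∃; ∃₂; _×_)
open import Relation.Binary.PropositionalEquality using (_≡_)

Odd : ℕ → Set
Odd n = ∃ λ m → n ≡ 2 * m + 1

IsPrimePower : ℕ → Set
IsPrimePower n = ∃₂ λ p m → Prime p × m ≥ 1 × n ≡ p ^ m

{-# OPTIONS --safe #-}
-- Write D = k² + 1. First, a small norm at a primitive vector is ±1: if
-- x² − D y² = ±a with x, y coprime and a ≤ k, then a = 1. Multiplying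
-- x + y√D by the unit √D − k, of norm −1, keeps the vector primitive, flips
-- the sign of the norm and, for x, y ≥ 0, replaces y by |x − k y| < y; the
-- descent ends at y = 0, where the norm is x² = 1.
--
-- Now let f' = pᵉ. From (x − y)(x + y) = f'²(f²y² + 1) and since the odd
-- prime p cannot divide both x − y and x + y, we get (changing the sign of y)
-- x = y + t f'². The equation then reads f'²t² + 2ty − f²y² = 1, which says
-- that (f²y − t, t) is a primitive vector of norm −f². Whichever of f, f' is
-- smaller, the norm f'² or −f² is a square of size at most f f' = k, and
-- the first part rules it out.
module Submission where

open import Defs
open import Data.Nat using (ℕ; _*_; _+_; _<_; _^_)
open import Data.Integer using (ℤ; +_) renaming (_*_ to _*ℤ_; _-_ to _-ℤ_; _+_ to _+ℤ_)
open import Data.Integer.Coprimality using (Coprime)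
open import Relation.Binary.PropositionalEquality using (_≡_)
open import Relation.Nullary using (¬_)

open import Data.Integer using (-_; -[1+_]; ∣_∣; _⊖_; 1ℤ)
import Data.Integer.Divisibility.Signed as ℤ∣
import Data.Integer.Properties as ℤ
open import Data.Integer.Tactic.RingSolver using (solve)
open import Data.List using (_∷_; [])
open import Data.Nat using (zero; suc; z<s; _≤_; ∣_-_∣; NonZero; >-nonZero; >-nonZero⁻¹)
import Data.Nat.Coprimality as ℕ
open import Data.Nat.Divisibility
  using (_∣_; divides; _∣?_; ∣-trans; ∣1⇒≡1; 1∣_; m∣m*n; ∣m⇒∣m*n; ∣n⇒∣m*n; ∣m+n∣m⇒∣n; *-monoʳ-∣; *-cancelˡ-∣)
open import Data.Nat.Induction using (<-wellFounded)
open import Data.Nat.Primality using (Prime; euclidsLemma; ¬prime[1]; prime⇒nonZero)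
open import Data.Nat.Properties
import Data.Nat.Tactic.RingSolver as ℕ-Ring
open import Data.Product using (_×_; _,_)
open import Data.Sum using (_⊎_; inj₁; inj₂; [_,_]′)
open import Function using (_∘_)
open import Induction.WellFounded using (Acc; acc)
open import Relation.Binary.PropositionalEquality
  using (_≢_; refl; sym; trans; cong; cong₂; subst; module ≡-Reasoning)
open import Relation.Nullary using (yes; no; contradiction)

∣m-n∣≤o⇒m≤n+o : ∀ m n {o} → ∣ m - n ∣ ≤ o → m ≤ n + o
∣m-n∣≤o⇒m≤n+o m n ∣m-n∣≤o = ≤-trans (m≤n+∣m-n∣ m n) (+-monoʳ-≤ n ∣m-n∣≤o)

m<n+o∧n<m+o⇒∣m-n∣<o : ∀ {m n o} .{{_ : NonZero o}} → m < n + o → n < m + o → ∣ m - n ∣ < o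
m<n+o∧n<m+o⇒∣m-n∣<o {m} {n} m<n+o n<m+o with ∣m-n∣≡[m∸n]∨[n∸m] m n
... | inj₁ eq rewrite eq = m<n+o⇒m∸n<o m n m<n+o
... | inj₂ eq rewrite eq = m<n+o⇒m∸n<o n m n<m+o

m*m<n*n⇒m<n : ∀ {m n} → m * m < n * n → m < n
m*m<n*n⇒m<n m*m<n*n = ≰⇒> λ n≤m → <⇒≱ m*m<n*n (*-mono-≤ n≤m n≤m)

m<m*n⇒1<n : ∀ m {n} → m < m * n → 1 < n
m<m*n⇒1<n m m<m*n = ≰⇒> λ n≤1 → <⇒≱ m<m*n (≤-trans (*-monoʳ-≤ m n≤1) (≤-reflexive (*-identityʳ m)))

∣X²-[k²+1]Y²∣≤k⇒∣X-kY∣<Y : ∀ {k X Y} .{{_ : NonZero Y}} → 1 ≤ k →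
  ∣ X * X - (k * k + 1) * (Y * Y) ∣ ≤ k → ∣ X - k * Y ∣ < Y
∣X²-[k²+1]Y²∣≤k⇒∣X-kY∣<Y {k} {X} {Y} k≥1 near = m<n+o∧n<m+o⇒∣m-n∣<o X<kY+Y kY<X+Y
  where
  open ≤-Reasoning
  instance
    Y²≢0 : NonZero (Y * Y)
    Y²≢0 = m*n≢0 Y Y

  k≤kY² : k ≤ k * (Y * Y)
  k≤kY² = m≤m*n k (Y * Y)

  X<kY+Y : X < k * Y + Y
  X<kY+Y = m*m<n*n⇒m<n (begin-strict
    X * X                                                ≤⟨ ∣m-n∣≤o⇒m≤n+o _ _ near ⟩
    (k * k + 1) * (Y * Y) + k                            <⟨ +-monoʳ-< _ k<2kY² ⟩
    (k * k + 1) * (Y * Y) + (k * (Y * Y) + k * (Y * Y))  ≡⟨ ℕ-Ring.solve (k ∷ Y ∷ []) ⟩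
    (k * Y + Y) * (k * Y + Y)                            ∎)
    where
    k<2kY² : k < k * (Y * Y) + k * (Y * Y)
    k<2kY² = <-≤-trans (m<m+n k k≥1) (+-mono-≤ k≤kY² k≤kY²)

  X²+k<[k²+1]Y² : X + Y ≤ k * Y → X * X + k < (k * k + 1) * (Y * Y)
  X²+k<[k²+1]Y² X+Y≤kY = begin-strict
    X * X + k                               <⟨ +-mono-≤-< (*-monoʳ-≤ X (m+n≤o⇒m≤o X X+Y≤kY))
                                                          (≤-<-trans k≤kY² (m<m+n _ (>-nonZero⁻¹ (Y * Y)))) ⟩
    X * (k * Y) + (k * (Y * Y) + Y * Y)     ≡⟨ ℕ-Ring.solve (k ∷ X ∷ Y ∷ []) ⟩
    (X + Y) * (k * Y) + Y * Y               ≤⟨ +-monoˡ-≤ (Y * Y) (*-monoˡ-≤ (k * Y) X+Y≤kY) ⟩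
    k * Y * (k * Y) + Y * Y                 ≡⟨ ℕ-Ring.solve (k ∷ Y ∷ []) ⟩
    (k * k + 1) * (Y * Y)                   ∎

  kY<X+Y : k * Y < X + Y
  kY<X+Y = ≰⇒> λ X+Y≤kY →
    <⇒≱ (X²+k<[k²+1]Y² X+Y≤kY) (∣m-n∣≤o⇒m≤n+o _ _ (subst (_≤ k) (∣-∣-comm (X * X) _) near))

p^e∣m*n∧p∤n⇒p^e∣m : ∀ {p m n} → Prime p → ¬ p ∣ n → ∀ e → p ^ e ∣ m * n → p ^ e ∣ m
p^e∣m*n∧p∤n⇒p^e∣m {m = m} _ _ zero _ = 1∣ m
p^e∣m*n∧p∤n⇒p^e∣m {p} {m} {n} p-prime p∤n (suc e) p^[1+e]∣mn
  with euclidsLemma m n p-prime (∣-trans (m∣m*n (p ^ e)) p^[1+e]∣mn)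
... | inj₂ p∣n = contradiction p∣n p∤n
... | inj₁ (divides q refl) = subst (p * p ^ e ∣_) (*-comm p q) (*-monoʳ-∣ p p^e∣q)
  where
  instance
    p≢0 : NonZero p
    p≢0 = prime⇒nonZero p-prime
  qp*n≡p*qn : q * p * n ≡ p * (q * n)
  qp*n≡p*qn = ℕ-Ring.solve (p ∷ q ∷ n ∷ [])
  p^e∣q : p ^ e ∣ q
  p^e∣q = p^e∣m*n∧p∤n⇒p^e∣m p-prime p∤n e
    (*-cancelˡ-∣ p (subst (p * p ^ e ∣_) qp*n≡p*qn p^[1+e]∣mn))

∣odd∧∣2⇒≡1 : ∀ {n d} → Odd n → d ∣ n → d ∣ 2 → d ≡ 1
∣odd∧∣2⇒≡1 (m , refl) d∣n d∣2 = ∣1⇒≡1 (∣m+n∣m⇒∣n d∣n (∣m⇒∣m*n m d∣2))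

∣m⊖n∣≡∣m-n∣ : ∀ m n → ∣ m ⊖ n ∣ ≡ ∣ m - n ∣
∣m⊖n∣≡∣m-n∣ m n with ≤-total n m
... | inj₁ n≤m = trans (cong ∣_∣ (ℤ.⊖-≥ n≤m)) (sym (m≤n⇒∣n-m∣≡n∸m n≤m))
... | inj₂ m≤n = trans (ℤ.∣⊖∣-≤ m≤n) (sym (m≤n⇒∣m-n∣≡n∸m m≤n))

∣[+m]-[+n]∣≡∣m-n∣ : ∀ m n → ∣ + m -ℤ + n ∣ ≡ ∣ m - n ∣
∣[+m]-[+n]∣≡∣m-n∣ m n = trans (cong ∣_∣ (ℤ.[+m]-[+n]≡m⊖n m n)) (∣m⊖n∣≡∣m-n∣ m n)

+[k*k+1]≡+k*+k+1 : ∀ k → + (k * k + 1) ≡ + k *ℤ + k +ℤ 1ℤ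
+[k*k+1]≡+k*+k+1 k = trans (ℤ.pos-+ (k * k) 1) (cong (_+ℤ 1ℤ) (ℤ.pos-* k k))

+[fg*fg+1]≡+[f*f]*+[g*g]+1 : ∀ f g → + (f * g * (f * g) + 1) ≡ + (f * f) *ℤ + (g * g) +ℤ 1ℤ
+[fg*fg+1]≡+[f*f]*+[g*g]+1 f g = begin
  + (f * g * (f * g) + 1)        ≡⟨ cong (λ n → + (n + 1)) (ℕ-Ring.solve (f ∷ g ∷ [])) ⟩
  + (f * f * (g * g) + 1)        ≡⟨ ℤ.pos-+ (f * f * (g * g)) 1 ⟩
  + (f * f * (g * g)) +ℤ 1ℤ      ≡⟨ cong (_+ℤ 1ℤ) (ℤ.pos-* (f * f) (g * g)) ⟩
  + (f * f) *ℤ + (g * g) +ℤ 1ℤ   ∎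
  where open ≡-Reasoning

∣-linear-combination : ∀ {d x y} a b → d ℤ∣.∣ x → d ℤ∣.∣ y → d ℤ∣.∣ a *ℤ x +ℤ b *ℤ y
∣-linear-combination a b d∣x d∣y = ℤ∣.∣m∣n⇒∣m+n (ℤ∣.∣n⇒∣m*n a d∣x) (ℤ∣.∣n⇒∣m*n b d∣y)

coprime-spanning : ∀ {x y x' y'} a b c e →
  a *ℤ x' +ℤ b *ℤ y' ≡ x → c *ℤ x' +ℤ e *ℤ y' ≡ y → Coprime x y → Coprime x' y'
coprime-spanning {x' = x'} {y'} a b c e x≡ y≡ cop {d} (d∣x' , d∣y') =
  cop (ℤ∣.∣⇒∣ᵤ (subst (+ d ℤ∣.∣_) x≡ (∣-linear-combination a b d∣x'ℤ d∣y'ℤ))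
     , ℤ∣.∣⇒∣ᵤ (subst (+ d ℤ∣.∣_) y≡ (∣-linear-combination c e d∣x'ℤ d∣y'ℤ)))
  where
  d∣x'ℤ : + d ℤ∣.∣ x'
  d∣x'ℤ = ℤ∣.∣ᵤ⇒∣ d∣x'
  d∣y'ℤ : + d ℤ∣.∣ y'
  d∣y'ℤ = ℤ∣.∣ᵤ⇒∣ d∣y'

bézout⇒coprime : ∀ {x y} a b → a *ℤ x +ℤ b *ℤ y ≡ 1ℤ → Coprime x y
bézout⇒coprime {x} {y} a b eq {d} (d∣x , d∣y) = ∣1⇒≡1 (ℤ∣.∣⇒∣ᵤ (subst (+ d ℤ∣.∣_) eq
  (∣-linear-combination a b (ℤ∣.∣ᵤ⇒∣ {+ d} {x} d∣x) (ℤ∣.∣ᵤ⇒∣ {+ d} {y} d∣y))))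

norm : ℤ → ℤ → ℤ → ℤ
norm d x y = x *ℤ x -ℤ d *ℤ (y *ℤ y)

+∣i∣*+∣i∣≡i*i : ∀ i → + ∣ i ∣ *ℤ + ∣ i ∣ ≡ i *ℤ i
+∣i∣*+∣i∣≡i*i (+ n)      = refl
+∣i∣*+∣i∣≡i*i -[1+ n ]   = refl

norm-abs : ∀ d x y → norm d (+ ∣ x ∣) (+ ∣ y ∣) ≡ norm d x y
norm-abs d x y = cong₂ (λ a b → a -ℤ d *ℤ b) (+∣i∣*+∣i∣≡i*i x) (+∣i∣*+∣i∣≡i*i y)

norm-neg : ∀ d x y → norm d x (- y) ≡ norm d x y
norm-neg d x y = begin
  norm d x (- y)                  ≡⟨ norm-abs d x (- y) ⟨
  norm d (+ ∣ x ∣) (+ ∣ - y ∣)    ≡⟨ cong (λ n → norm d (+ ∣ x ∣) (+ n)) (ℤ.∣-i∣≡∣i∣ y) ⟩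
  norm d (+ ∣ x ∣) (+ ∣ y ∣)      ≡⟨ norm-abs d x y ⟩
  norm d x y                      ∎
  where open ≡-Reasoning

∣norm∣≡∣X²-dY²∣ : ∀ d X Y → ∣ norm (+ d) (+ X) (+ Y) ∣ ≡ ∣ X * X - d * (Y * Y) ∣
∣norm∣≡∣X²-dY²∣ d X Y = trans (cong ∣_∣ norm≡) (∣[+m]-[+n]∣≡∣m-n∣ (X * X) (d * (Y * Y)))
  where
  open ≡-Reasoning
  norm≡ : norm (+ d) (+ X) (+ Y) ≡ + (X * X) -ℤ + (d * (Y * Y))
  norm≡ = begin
    + X *ℤ + X -ℤ + d *ℤ (+ Y *ℤ + Y)  ≡⟨ cong₂ (λ a b → a -ℤ + d *ℤ b) (ℤ.pos-* X X) (ℤ.pos-* Y Y) ⟨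
    + (X * X) -ℤ + d *ℤ + (Y * Y)      ≡⟨ cong (+ (X * X) -ℤ_) (ℤ.pos-* d (Y * Y)) ⟨
    + (X * X) -ℤ + (d * (Y * Y))       ∎

norm-twist : ∀ {d} k x y → d ≡ k *ℤ k +ℤ 1ℤ → norm d (d *ℤ y -ℤ k *ℤ x) (x -ℤ k *ℤ y) ≡ - norm d x y
norm-twist k x y refl = begin
  ((k *ℤ k +ℤ 1ℤ) *ℤ y -ℤ k *ℤ x) *ℤ ((k *ℤ k +ℤ 1ℤ) *ℤ y -ℤ k *ℤ x)
    -ℤ (k *ℤ k +ℤ 1ℤ) *ℤ ((x -ℤ k *ℤ y) *ℤ (x -ℤ k *ℤ y))  ≡⟨ solve (k ∷ x ∷ y ∷ []) ⟩
  - (x *ℤ x -ℤ (k *ℤ k +ℤ 1ℤ) *ℤ (y *ℤ y))                ∎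
  where open ≡-Reasoning

coprime-twist : ∀ {d} k x y → d ≡ k *ℤ k +ℤ 1ℤ → Coprime x y → Coprime (d *ℤ y -ℤ k *ℤ x) (x -ℤ k *ℤ y)
coprime-twist {d} k x y d≡ = coprime-spanning k d 1ℤ k (inverseˣ d≡) (inverseʸ d≡)
  where
  inverseˣ : ∀ {d} → d ≡ k *ℤ k +ℤ 1ℤ → k *ℤ (d *ℤ y -ℤ k *ℤ x) +ℤ d *ℤ (x -ℤ k *ℤ y) ≡ x
  inverseˣ refl = solve (k ∷ x ∷ y ∷ [])
  inverseʸ : ∀ {d} → d ≡ k *ℤ k +ℤ 1ℤ → 1ℤ *ℤ (d *ℤ y -ℤ k *ℤ x) +ℤ k *ℤ (x -ℤ k *ℤ y) ≡ y
  inverseʸ refl = solve (k ∷ x ∷ y ∷ [])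

small-norm⇒unit : ∀ {k} → 1 ≤ k → ∀ x y → Coprime x y →
  ∣ norm (+ (k * k + 1)) x y ∣ ≤ k → ∣ norm (+ (k * k + 1)) x y ∣ ≡ 1
small-norm⇒unit {k} k≥1 x y cop small =
  trans ∣norm∣≡ (descent (<-wellFounded ∣ y ∣) ∣ x ∣ cop (subst (_≤ k) ∣norm∣≡ small))
  where
  D : ℤ
  D = + (k * k + 1)

  ∣norm∣≡ : ∣ norm D x y ∣ ≡ ∣ norm D (+ ∣ x ∣) (+ ∣ y ∣) ∣
  ∣norm∣≡ = cong ∣_∣ (sym (norm-abs D x y))

  descent : ∀ {Y} → Acc _<_ Y → ∀ X → ℕ.Coprime X Y →
    ∣ norm D (+ X) (+ Y) ∣ ≤ k → ∣ norm D (+ X) (+ Y) ∣ ≡ 1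
  descent {zero} _ X cop _ = begin
    ∣ norm D (+ X) (+ 0) ∣           ≡⟨ ∣norm∣≡∣X²-dY²∣ (k * k + 1) X 0 ⟩
    ∣ X * X - (k * k + 1) * 0 ∣      ≡⟨ cong (λ n → ∣ X * X - n ∣) (*-zeroʳ (k * k + 1)) ⟩
    ∣ X * X - 0 ∣                    ≡⟨ ∣-∣-identityʳ (X * X) ⟩
    X * X                            ≡⟨ cong (λ n → n * n) (ℕ.0-coprimeTo-m⇒m≡1 (ℕ.sym cop)) ⟩
    1                                ∎
    where open ≡-Reasoning
  descent {Y@(suc _)} (acc smaller) X cop small =
    trans (sym same) (descent (smaller shrinks) ∣ x' ∣ cop' (subst (_≤ k) (sym same) small))
    where
    open ≡-Reasoning
    x' y' : ℤ
    x' = D *ℤ + Y -ℤ + k *ℤ + X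
    y' = + X -ℤ + k *ℤ + Y

    cop' : Coprime x' y'
    cop' = coprime-twist (+ k) (+ X) (+ Y) (+[k*k+1]≡+k*+k+1 k) cop

    same : ∣ norm D (+ ∣ x' ∣) (+ ∣ y' ∣) ∣ ≡ ∣ norm D (+ X) (+ Y) ∣
    same = begin
      ∣ norm D (+ ∣ x' ∣) (+ ∣ y' ∣) ∣  ≡⟨ cong ∣_∣ (norm-abs D x' y') ⟩
      ∣ norm D x' y' ∣                   ≡⟨ cong ∣_∣ (norm-twist (+ k) (+ X) (+ Y) (+[k*k+1]≡+k*+k+1 k)) ⟩
      ∣ - norm D (+ X) (+ Y) ∣           ≡⟨ ℤ.∣-i∣≡∣i∣ (norm D (+ X) (+ Y)) ⟩
      ∣ norm D (+ X) (+ Y) ∣             ∎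

    ∣y'∣≡ : ∣ y' ∣ ≡ ∣ X - k * Y ∣
    ∣y'∣≡ = trans (cong (λ z → ∣ + X -ℤ z ∣) (sym (ℤ.pos-* k Y))) (∣[+m]-[+n]∣≡∣m-n∣ X (k * Y))

    shrinks : ∣ y' ∣ < Y
    shrinks = subst (_< Y) (sym ∣y'∣≡)
      (∣X²-[k²+1]Y²∣≤k⇒∣X-kY∣<Y {X = X} k≥1 (subst (_≤ k) (∣norm∣≡∣X²-dY²∣ (k * k + 1) X Y) small))

∣norm∣≢small-square : ∀ {k a} x y → 1 < a → a * a ≤ k → Coprime x y →
  ∣ norm (+ (k * k + 1)) x y ∣ ≢ a * a
∣norm∣≢small-square {k} {a} x y 1<a a²≤k cop ∣N∣≡a² = <⇒≢ 1<a² (sym (trans (sym ∣N∣≡a²) unit))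
  where
  1<a² : 1 < a * a
  1<a² = *-mono-< 1<a 1<a
  unit : ∣ norm (+ (k * k + 1)) x y ∣ ≡ 1
  unit = small-norm⇒unit (≤-trans (<⇒≤ 1<a²) a²≤k) x y cop (subst (_≤ _) (sym ∣N∣≡a²) a²≤k)

conjugate-solution : ∀ {D F G x y} t .{{_ : NonZero ∣ G ∣}} → D ≡ F *ℤ G +ℤ 1ℤ →
  x ≡ y +ℤ t *ℤ G → norm D x y ≡ G →
  Coprime (F *ℤ y -ℤ t) t × norm D (F *ℤ y -ℤ t) t ≡ - F
conjugate-solution {F = F} {G} {y = y} t refl refl eq = bézout⇒coprime (- y) (G *ℤ t +ℤ y) bézout , norm≡-F
  where
  open ≡-Reasoning
  cofactor≡1 : G *ℤ t *ℤ t +ℤ (t *ℤ y +ℤ t *ℤ y) -ℤ F *ℤ y *ℤ y ≡ 1ℤ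
  cofactor≡1 = ℤ.*-cancelˡ-≡ G _ 1ℤ (begin
    G *ℤ (G *ℤ t *ℤ t +ℤ (t *ℤ y +ℤ t *ℤ y) -ℤ F *ℤ y *ℤ y)     ≡⟨ solve (F ∷ G ∷ y ∷ t ∷ []) ⟩
    (y +ℤ t *ℤ G) *ℤ (y +ℤ t *ℤ G) -ℤ (F *ℤ G +ℤ 1ℤ) *ℤ (y *ℤ y) ≡⟨ eq ⟩
    G                                                             ≡⟨ ℤ.*-identityʳ G ⟨
    G *ℤ 1ℤ                                                       ∎)

  bézout : - y *ℤ (F *ℤ y -ℤ t) +ℤ (G *ℤ t +ℤ y) *ℤ t ≡ 1ℤ
  bézout = begin
    - y *ℤ (F *ℤ y -ℤ t) +ℤ (G *ℤ t +ℤ y) *ℤ t              ≡⟨ solve (F ∷ G ∷ y ∷ t ∷ []) ⟩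
    G *ℤ t *ℤ t +ℤ (t *ℤ y +ℤ t *ℤ y) -ℤ F *ℤ y *ℤ y        ≡⟨ cofactor≡1 ⟩
    1ℤ                                                      ∎

  norm≡-F : norm (F *ℤ G +ℤ 1ℤ) (F *ℤ y -ℤ t) t ≡ - F
  norm≡-F = begin
    (F *ℤ y -ℤ t) *ℤ (F *ℤ y -ℤ t) -ℤ (F *ℤ G +ℤ 1ℤ) *ℤ (t *ℤ t)  ≡⟨ solve (F ∷ G ∷ y ∷ t ∷ []) ⟩
    - (F *ℤ (G *ℤ t *ℤ t +ℤ (t *ℤ y +ℤ t *ℤ y) -ℤ F *ℤ y *ℤ y))   ≡⟨ cong (λ c → - (F *ℤ c)) cofactor≡1 ⟩
    - (F *ℤ 1ℤ)                                                   ≡⟨ cong -_ (ℤ.*-identityʳ F) ⟩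
    - F                                                           ∎

norm≡g²⇒g²∤x±y : ∀ {f g} x y → 1 < f → f ≤ g → Coprime x y →
  norm (+ (f * g * (f * g) + 1)) x y ≡ + (g * g) → ¬ ((g * g ∣ ∣ x -ℤ y ∣) ⊎ (g * g ∣ ∣ x +ℤ y ∣))
norm≡g²⇒g²∤x±y {f} {g} x y 1<f f≤g cop eq =
  [ g²∤x-y y cop eq
  , g²∤x-y (- y) (subst (ℕ.Coprime ∣ x ∣) (sym (ℤ.∣-i∣≡∣i∣ y)) cop) (trans (norm-neg (+ (f * g * (f * g) + 1)) x y) eq)
      ∘ subst (λ z → g * g ∣ ∣ x +ℤ z ∣) (sym (ℤ.neg-involutive y)) ]′
  where
  instance
    g≢0 : NonZero g
    g≢0 = >-nonZero (<-≤-trans (<-trans z<s 1<f) f≤g)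
    g²≢0 : NonZero (g * g)
    g²≢0 = m*n≢0 g g

  g²∤x-y : ∀ y → Coprime x y → norm (+ (f * g * (f * g) + 1)) x y ≡ + (g * g) → ¬ g * g ∣ ∣ x -ℤ y ∣
  g²∤x-y y cop eq g²∣x-y with ℤ∣.∣ᵤ⇒∣ {+ (g * g)} {x -ℤ y} g²∣x-y
  ... | ℤ∣.divides t x-y≡tg² =
    let cop' , eq' = conjugate-solution {F = + (f * f)} t (+[fg*fg+1]≡+[f*f]*+[g*g]+1 f g) x≡y+tg² eq
    in  ∣norm∣≢small-square (+ (f * f) *ℤ y -ℤ t) t 1<f (*-monoʳ-≤ f f≤g) cop'
          (trans (cong ∣_∣ eq') (ℤ.∣-i∣≡∣i∣ (+ (f * f))))
    where
    x≡y+tg² : x ≡ y +ℤ t *ℤ + (g * g)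
    x≡y+tg² = begin
      x                    ≡⟨ solve (x ∷ y ∷ []) ⟩
      y +ℤ (x -ℤ y)        ≡⟨ cong (y +ℤ_) x-y≡tg² ⟩
      y +ℤ t *ℤ + (g * g)  ∎
      where open ≡-Reasoning

prime∣x-y∧prime∣x+y⇒∣2 : ∀ {p} x y → Prime p → Coprime x y → p ∣ ∣ x -ℤ y ∣ → p ∣ ∣ x +ℤ y ∣ → p ∣ 2
prime∣x-y∧prime∣x+y⇒∣2 {p} x y p-prime cop p∣x-y p∣x+y
  with euclidsLemma 2 ∣ x ∣ p-prime (p∣2* x sum≡2x (ℤ∣.∣m∣n⇒∣m+n +p∣x-y +p∣x+y))
     | euclidsLemma 2 ∣ y ∣ p-prime (p∣2* y difference≡2y (ℤ∣.∣m∣n⇒∣m-n +p∣x+y +p∣x-y))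
  where
  sum≡2x : x -ℤ y +ℤ (x +ℤ y) ≡ + 2 *ℤ x
  sum≡2x = solve (x ∷ y ∷ [])
  difference≡2y : x +ℤ y -ℤ (x -ℤ y) ≡ + 2 *ℤ y
  difference≡2y = solve (x ∷ y ∷ [])
  +p∣x-y : + p ℤ∣.∣ x -ℤ y
  +p∣x-y = ℤ∣.∣ᵤ⇒∣ p∣x-y
  +p∣x+y : + p ℤ∣.∣ x +ℤ y
  +p∣x+y = ℤ∣.∣ᵤ⇒∣ p∣x+y
  p∣2* : ∀ z {w} → w ≡ + 2 *ℤ z → + p ℤ∣.∣ w → p ∣ 2 * ∣ z ∣
  p∣2* z w≡2z p∣w = subst (p ∣_) (ℤ.abs-* (+ 2) z) (ℤ∣.∣⇒∣ᵤ (subst (+ p ℤ∣.∣_) w≡2z p∣w))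
... | inj₁ p∣2 | _         = p∣2
... | inj₂ _   | inj₁ p∣2  = p∣2
... | inj₂ p∣x | inj₂ p∣y  = contradiction (subst Prime (cop (p∣x , p∣y)) p-prime) ¬prime[1]

prime-power²∣x-y⊎x+y : ∀ {p} x y e → Prime p → ¬ p ∣ 2 → Coprime x y →
  p ^ e * p ^ e ∣ ∣ x -ℤ y ∣ * ∣ x +ℤ y ∣ → (p ^ e * p ^ e ∣ ∣ x -ℤ y ∣) ⊎ (p ^ e * p ^ e ∣ ∣ x +ℤ y ∣)
prime-power²∣x-y⊎x+y {p} x y e p-prime p∤2 cop rewrite sym (^-distribˡ-+-* p e e) with p ∣? ∣ x +ℤ y ∣
... | no p∤x+y = inj₁ ∘ p^e∣m*n∧p∤n⇒p^e∣m p-prime p∤x+y (e + e)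
... | yes p∣x+y = inj₂ ∘ p^e∣m*n∧p∤n⇒p^e∣m p-prime p∤x-y (e + e) ∘ subst (p ^ (e + e) ∣_) (*-comm ∣ x -ℤ y ∣ _)
  where
  p∤x-y : ¬ p ∣ ∣ x -ℤ y ∣
  p∤x-y p∣x-y = p∤2 (prime∣x-y∧prime∣x+y⇒∣2 x y p-prime cop p∣x-y p∣x+y)

norm≡G⇒∣G∣∣[x-y][x+y] : ∀ {D} F {G} x y → D ≡ F *ℤ G +ℤ 1ℤ → norm D x y ≡ G →
  ∣ G ∣ ∣ ∣ x -ℤ y ∣ * ∣ x +ℤ y ∣
norm≡G⇒∣G∣∣[x-y][x+y] F {G} x y refl eq =
  subst (∣ G ∣ ∣_) (ℤ.abs-* (x -ℤ y) (x +ℤ y)) (ℤ∣.∣⇒∣ᵤ (ℤ∣.divides (F *ℤ (y *ℤ y) +ℤ 1ℤ) (begin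
    (x -ℤ y) *ℤ (x +ℤ y)                                          ≡⟨ solve (F ∷ G ∷ x ∷ y ∷ []) ⟩
    x *ℤ x -ℤ (F *ℤ G +ℤ 1ℤ) *ℤ (y *ℤ y) +ℤ G *ℤ (F *ℤ (y *ℤ y))  ≡⟨ cong (_+ℤ G *ℤ (F *ℤ (y *ℤ y))) eq ⟩
    G +ℤ G *ℤ (F *ℤ (y *ℤ y))                                     ≡⟨ solve (F ∷ G ∷ y ∷ []) ⟩
    (F *ℤ (y *ℤ y) +ℤ 1ℤ) *ℤ G                                    ∎)))
  where open ≡-Reasoning

lemma3p3 : (k f f' : ℕ) → k ≡ f * f' → Odd k → 1 < f → f < k →
    (x y : ℤ) → Coprime x y →
    x *ℤ x -ℤ (+ (k * k + 1)) *ℤ (y *ℤ y) ≡ + (f' * f') →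
    ¬ IsPrimePower f'
lemma3p3 k f f' refl k-odd 1<f f<k x y cop eq (_ , zero , _ , () , _)
lemma3p3 k f f' refl k-odd 1<f f<k x y cop eq (p , e@(suc e-1) , p-prime , _ , refl) =
  [ (λ f'≤f → ∣norm∣≢small-square x y (m<m*n⇒1<n f f<k) (*-monoˡ-≤ f' f'≤f) cop (cong ∣_∣ eq))
  , (λ f≤f' → norm≡g²⇒g²∤x±y x y 1<f f≤f' cop eq (prime-power²∣x-y⊎x+y x y e p-prime p∤2 cop
                (norm≡G⇒∣G∣∣[x-y][x+y] (+ (f * f)) x y (+[fg*fg+1]≡+[f*f]*+[g*g]+1 f f') eq)))
  ]′ (≤-total f' f)
  where
  p∤2 : ¬ p ∣ 2
  p∤2 p∣2 = ¬prime[1] (subst Prime (∣odd∧∣2⇒≡1 k-odd (∣n⇒∣m*n f (m∣m*n (p ^ e-1))) p∣2) p-prime)
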